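{- Let $A$ be the adjacency matrix of the complete graph $K_n$ and let $C$ be the binary code generated by $[I_n|A]$. Then $C$ is self-dual if and only if $n$ is even. Moreover, if $n\ge 4$ is even: (a) if $n$ is divisible by $4$, then $C$ is a Type II self-dual $[2n,n,4]$ code; (b) if $n$ is not divisible by $4$, then $C$ is a Type I self-dual $[2n,n,4]$ code.
   Context: The code generated by a matrix over $\mathbb{F}_2$ is its row space. A binary code $C$ is self-dual if $C=C^\perp$. A self-dual binary code is Type II if every codeword has Hamming weight divisible by $4$, Type I otherwise. An $[N,k,d]$ code has length $N$, dimension $k$ and minimum distance (minimum nonzero Hamming weight) $d$. -}

module Defs where

open import Data.Bool using (Bool; true; false; _xor_; not; if_then_else_)
open import Data.Nat using (ℕ; zero; suc; _+_; _≥_)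
open import Data.Nat.Divisibility using (_∣_)
open import Data.Fin using (Fin; zero; suc; splitAt)
open import Data.Fin.Properties using (_≟_)
open import Data.Sum using (inj₁; inj₂)
open import Data.Product using (Σ; ∃; _×_)
open import Function using (_∘_)
open import Function.Bundles using (_⇔_)
open import Relation.Nullary using (¬_)
open import Relation.Nullary.Decidable using (⌊_⌋)
open import Relation.Binary.PropositionalEquality using (_≡_)

-- 𝔽₂ is modelled by Bool with addition _xor_ and multiplication _∧_.
open import Data.Bool using (_∧_) public

Word : ℕ → Set
Word N = Fin N → Bool

Code : ℕ → Set₁
Code N = Word N → Set

⊕ : ∀ {k} → (Fin k → Bool) → Bool
⊕ {zero}  f = false
⊕ {suc k} f = f zero xor ⊕ (f ∘ suc)

wt : ∀ {N} → Word N → ℕ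
wt {zero}  v = 0
wt {suc N} v = (if v zero then 1 else 0) + wt (v ∘ suc)

_·_ : ∀ {N} → Word N → Word N → Bool
u · v = ⊕ (λ j → u j ∧ v j)

𝟘 : ∀ {N} → Word N
𝟘 _ = false

lincomb : ∀ {k N} → (Fin k → Word N) → (Fin k → Bool) → Word N
lincomb G c j = ⊕ (λ i → c i ∧ G i j)

RowSpace : ∀ {k N} → (Fin k → Word N) → Code N
RowSpace G v = ∃ λ c → ∀ j → v j ≡ lincomb G c j

Dual : ∀ {N} → Code N → Code N
Dual C v = ∀ w → C w → v · w ≡ false

SelfDual : ∀ {N} → Code N → Set
SelfDual C = ∀ v → C v ⇔ Dual C v

LinIndep : ∀ {k N} → (Fin k → Word N) → Set
LinIndep B = ∀ c → (∀ j → lincomb B c j ≡ false) → ∀ i → c i ≡ false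

HasDim : ∀ {N} → Code N → ℕ → Set
HasDim {N} C k = Σ (Fin k → Word N) λ B →
  LinIndep B × (∀ v → C v ⇔ RowSpace B v)

HasMinDist : ∀ {N} → Code N → ℕ → Set
HasMinDist C d =
  (∃ λ v → C v × ¬ (∀ j → v j ≡ false) × wt v ≡ d) ×
  (∀ v → C v → ¬ (∀ j → v j ≡ false) → wt v ≥ d)

-- C is an [N,k,d] code (the length N is carried in the type).
IsCodeParams : ∀ {N} → Code N → ℕ → ℕ → Set
IsCodeParams C k d = HasDim C k × HasMinDist C d

TypeII : ∀ {N} → Code N → Set
TypeII C = SelfDual C × (∀ v → C v → 4 ∣ wt v)

TypeI : ∀ {N} → Code N → Set
TypeI C = SelfDual C × ¬ (∀ v → C v → 4 ∣ wt v)

adjK : (n : ℕ) → Fin n → Fin n → Bool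
adjK n i j = not ⌊ i ≟ j ⌋

idM : (n : ℕ) → Fin n → Fin n → Bool
idM n i j = ⌊ i ≟ j ⌋

genK : (n : ℕ) → Fin n → Word (n + n)
genK n i j with splitAt n j
... | inj₁ a = idM n i a
... | inj₂ b = adjK n i b

CK : (n : ℕ) → Code (n + n)
CK n = RowSpace (genK n)

-- A codeword of C is (c | A c) with A c = (⊕ c) 𝟙 + c, because A = J + I over 𝔽₂.
-- Hence two codewords have inner product n (⊕ c)(⊕ d), so C is self-orthogonal
-- exactly when n is even; then any v ⊥ C is the codeword of its left half,
-- which is seen by pairing v with the rows of [I_n | A].  A codeword with
-- ⊕ c = 1 has weight wt c + (n − wt c) = n, and one with ⊕ c = 0 has weight
-- 2 wt c, where wt c is even.  So all weights are divisible by 4 when 4 ∣ n,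
-- the rows have weight n, and the minimum weight 4 is attained by c = e₀ + e₁.
module Submission where

open import Defs
open import Data.Nat using (ℕ; _≤_; _+_)
open import Data.Nat.Divisibility using (_∣_)
open import Data.Product using (_×_)
open import Function.Bundles using (_⇔_)
open import Relation.Nullary using (¬_)

open import Algebra.Bundles using (CommutativeRing)
open import Data.Bool using (Bool; true; false; _xor_; not; if_then_else_)
open import Data.Bool.Properties
  using ( xor-identityʳ; xor-assoc; not-involutive; ∧-distribˡ-xor
        ; ∧-identityʳ; ∧-zeroʳ; ∧-comm; xor-∧-commutativeRing )
open import Algebra.Properties.CommutativeSemigroup
  (CommutativeRing.+-commutativeSemigroup xor-∧-commutativeRing) using (interchange)
open import Data.Fin using (Fin; zero; suc; splitAt; _↑ˡ_; _↑ʳ_)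
open import Data.Fin.Properties using (_≟_; splitAt⁻¹-↑ˡ; splitAt⁻¹-↑ʳ)
open import Data.Nat using (zero; suc; _*_; s≤s; ≢-nonZero)
open import Data.Nat.Divisibility using (divides; divides-refl; _∣0; ∣-refl; ∣m∣n⇒∣m+n; ∣⇒≤)
open import Data.Nat.Properties using (+-assoc; +-suc; *-distribˡ-+)
open import Data.Product using (_,_)
open import Data.Sum using (_⊎_; inj₁; inj₂; [_,_]′)
open import Data.Vec.Functional using (_++_)
open import Data.Vec.Functional.Properties using (lookup-++ˡ; lookup-++ʳ; ++-cong)
open import Function using (_∘_; id)
open import Function.Bundles using (mk⇔; Equivalence)
open import Relation.Nullary using (yes; no)
open import Relation.Nullary.Decidable using (⌊_⌋)
open import Relation.Binary.PropositionalEquality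
  using (_≡_; _≗_; refl; sym; trans; cong; cong₂; subst; module ≡-Reasoning)

open ≡-Reasoning

xor≡false⇒≡ : ∀ a b → a xor b ≡ false → a ≡ b
xor≡false⇒≡ false false _ = refl
xor≡false⇒≡ true  true  _ = refl

xor-cancelˡ : ∀ a b → a xor (a xor b) ≡ b
xor-cancelˡ false b = refl
xor-cancelˡ true  b = not-involutive b

xor-cancel-middle : ∀ a b c → (a xor b) xor (b xor c) ≡ a xor c
xor-cancel-middle false b     c = xor-cancelˡ b c
xor-cancel-middle true  false c = refl
xor-cancel-middle true  true  c = refl

xor-cancel-outer : ∀ a b → a xor (b xor a) ≡ b
xor-cancel-outer false b     = xor-identityʳ b
xor-cancel-outer true  false = refl
xor-cancel-outer true  true  = refl

⊕-cong : ∀ {k} {f g : Fin k → Bool} → f ≗ g → ⊕ f ≡ ⊕ g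
⊕-cong {zero}  f≗g = refl
⊕-cong {suc k} f≗g = cong₂ _xor_ (f≗g zero) (⊕-cong (f≗g ∘ suc))

⊕-xor : ∀ {k} (f g : Fin k → Bool) → ⊕ (λ i → f i xor g i) ≡ ⊕ f xor ⊕ g
⊕-xor {zero}  f g = refl
⊕-xor {suc k} f g =
  trans (cong ((f zero xor g zero) xor_) (⊕-xor (f ∘ suc) (g ∘ suc)))
        (interchange (f zero) (g zero) (⊕ (f ∘ suc)) (⊕ (g ∘ suc)))

⊕-∧ˡ : ∀ {k} b (f : Fin k → Bool) → ⊕ (λ i → b ∧ f i) ≡ b ∧ ⊕ f
⊕-∧ˡ {zero}  b f = sym (∧-zeroʳ b)
⊕-∧ˡ {suc k} b f =
  trans (cong ((b ∧ f zero) xor_) (⊕-∧ˡ b (f ∘ suc)))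
        (sym (∧-distribˡ-xor b (f zero) (⊕ (f ∘ suc))))

⊕-split : ∀ m {n} (f : Fin (m + n) → Bool) →
          ⊕ f ≡ ⊕ (f ∘ (_↑ˡ n)) xor ⊕ (f ∘ (m ↑ʳ_))
⊕-split zero    f = refl
⊕-split (suc m) f =
  trans (cong (f zero xor_) (⊕-split m (f ∘ suc))) (sym (xor-assoc (f zero) _ _))

isOdd : ℕ → Bool
isOdd n = ⊕ {n} (λ _ → true)

⊕-const : ∀ {n} b → ⊕ {n} (λ _ → b) ≡ b ∧ isOdd n
⊕-const {n} b = trans (⊕-cong {n} (λ _ → sym (∧-identityʳ b))) (⊕-∧ˡ {n} b (λ _ → true))

⊕-shift : ∀ {n} s (u : Word n) → ⊕ ((s xor_) ∘ u) ≡ (s ∧ isOdd n) xor ⊕ u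
⊕-shift {n} s u = trans (⊕-xor (λ _ → s) u) (cong (_xor ⊕ u) (⊕-const {n} s))

isOdd-suc-suc : ∀ n → isOdd (suc (suc n)) ≡ isOdd n
isOdd-suc-suc n = xor-cancelˡ true (isOdd n)

isOdd≡false⇔2∣ : ∀ n → isOdd n ≡ false ⇔ 2 ∣ n
isOdd≡false⇔2∣ n = mk⇔ (to n) from
  where
  to : ∀ n → isOdd n ≡ false → 2 ∣ n
  to zero          _ = 2 ∣0
  to (suc (suc n)) e = ∣m∣n⇒∣m+n ∣-refl (to n (trans (sym (isOdd-suc-suc n)) e))

  isOdd-double : ∀ q → isOdd (q * 2) ≡ false
  isOdd-double zero    = refl
  isOdd-double (suc q) = trans (isOdd-suc-suc (q * 2)) (isOdd-double q)

  from : 2 ∣ n → isOdd n ≡ false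
  from (divides-refl q) = isOdd-double q

unit : ∀ {n} → Fin n → Word n
unit i j = ⌊ j ≟ i ⌋

unit-suc : ∀ {n} (i j : Fin n) → unit (suc i) (suc j) ≡ unit i j
unit-suc i j with j ≟ i
... | yes _ = refl
... | no  _ = refl

·-cong : ∀ {n} {u u′ v v′ : Word n} → u ≗ u′ → v ≗ v′ → u · v ≡ u′ · v′
·-cong u≗u′ v≗v′ = ⊕-cong (λ j → cong₂ _∧_ (u≗u′ j) (v≗v′ j))

·-comm : ∀ {n} (u v : Word n) → u · v ≡ v · u
·-comm u v = ⊕-cong (λ j → ∧-comm (u j) (v j))

·-unit : ∀ {n} (u : Word n) i → u · unit i ≡ u i
·-unit {suc n} u zero =
  trans (cong ((u zero ∧ true) xor_) (trans (⊕-cong (λ j → ∧-zeroʳ (u (suc j)))) (⊕-const {n} false)))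
        (trans (xor-identityʳ _) (∧-identityʳ (u zero)))
·-unit {suc n} u (suc i) =
  trans (cong₂ _xor_ (∧-zeroʳ (u zero)) (⊕-cong (λ j → cong (u (suc j) ∧_) (unit-suc i j))))
        (·-unit (u ∘ suc) i)

⊕-unit : ∀ {n} (i : Fin n) → ⊕ (unit i) ≡ true
⊕-unit = ·-unit (λ _ → true)

·-shiftʳ : ∀ {n} (u v : Word n) t → u · ((t xor_) ∘ v) ≡ (t ∧ ⊕ u) xor u · v
·-shiftʳ u v t = begin
  ⊕ (λ j → u j ∧ (t xor v j))          ≡⟨ ⊕-cong (λ j → ∧-distribˡ-xor (u j) t (v j)) ⟩
  ⊕ (λ j → (u j ∧ t) xor (u j ∧ v j))  ≡⟨ ⊕-xor (λ j → u j ∧ t) (λ j → u j ∧ v j) ⟩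
  ⊕ (λ j → u j ∧ t) xor u · v          ≡⟨ cong (_xor u · v) (⊕-cong (λ j → ∧-comm (u j) t)) ⟩
  ⊕ (λ j → t ∧ u j) xor u · v          ≡⟨ cong (_xor u · v) (⊕-∧ˡ t u) ⟩
  (t ∧ ⊕ u) xor u · v                  ∎

·-shiftˡ : ∀ {n} s (u v : Word n) → ((s xor_) ∘ u) · v ≡ (s ∧ ⊕ v) xor u · v
·-shiftˡ s u v =
  trans (·-comm _ v) (trans (·-shiftʳ v u s) (cong ((s ∧ ⊕ v) xor_) (·-comm v u)))

·-shiftˡʳ : ∀ {n} s t (u v : Word n) →
            ((s xor_) ∘ u) · ((t xor_) ∘ v) ≡ (t ∧ ((s ∧ isOdd n) xor ⊕ u)) xor ((s ∧ ⊕ v) xor u · v)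
·-shiftˡʳ s t u v =
  trans (·-shiftʳ _ v t) (cong₂ (λ a b → (t ∧ a) xor b) (⊕-shift s u) (·-shiftˡ s u v))

·-++ : ∀ {m n} (u u′ : Word m) (v v′ : Word n) → (u ++ v) · (u′ ++ v′) ≡ u · u′ xor v · v′
·-++ {m} u u′ v v′ =
  trans (⊕-split m _)
        (cong₂ _xor_ (⊕-cong (λ a → cong₂ _∧_ (lookup-++ˡ u v a) (lookup-++ˡ u′ v′ a)))
                     (⊕-cong (λ b → cong₂ _∧_ (lookup-++ʳ u v b) (lookup-++ʳ u′ v′ b))))

++-halves : ∀ m {n} (v : Word (m + n)) → v ≗ (v ∘ (_↑ˡ n)) ++ (v ∘ (m ↑ʳ_))
++-halves m v j with splitAt m j in eq
... | inj₁ a = cong v (sym (splitAt⁻¹-↑ˡ eq))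
... | inj₂ b = cong v (sym (splitAt⁻¹-↑ʳ eq))

bit : Bool → ℕ
bit b = if b then 1 else 0

wt-cong : ∀ {n} {u v : Word n} → u ≗ v → wt u ≡ wt v
wt-cong {zero}  u≗v = refl
wt-cong {suc n} u≗v = cong₂ (λ b w → bit b + w) (u≗v zero) (wt-cong (u≗v ∘ suc))

wt-split : ∀ m {n} (v : Word (m + n)) → wt v ≡ wt (v ∘ (_↑ˡ n)) + wt (v ∘ (m ↑ʳ_))
wt-split zero    v = refl
wt-split (suc m) v =
  trans (cong (bit (v zero) +_) (wt-split m (v ∘ suc))) (sym (+-assoc (bit (v zero)) _ _))

wt-++ : ∀ {m n} (u : Word m) (v : Word n) → wt (u ++ v) ≡ wt u + wt v
wt-++ {m} u v =
  trans (wt-split m (u ++ v)) (cong₂ _+_ (wt-cong (lookup-++ˡ u v)) (wt-cong (lookup-++ʳ u v)))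

wt-𝟘 : ∀ {n} → wt {n} 𝟘 ≡ 0
wt-𝟘 {zero}  = refl
wt-𝟘 {suc n} = wt-𝟘 {n}

wt≡0⇒≗𝟘 : ∀ {n} (v : Word n) → wt v ≡ 0 → v ≗ 𝟘
wt≡0⇒≗𝟘 {suc n} v e j with v zero in eq
wt≡0⇒≗𝟘 {suc n} v e zero    | false = eq
wt≡0⇒≗𝟘 {suc n} v e (suc j) | false = wt≡0⇒≗𝟘 (v ∘ suc) e j

wt-complement : ∀ {n} (v : Word n) → wt v + wt (not ∘ v) ≡ n
wt-complement {zero}  v = refl
wt-complement {suc n} v with v zero
... | true  = cong suc (wt-complement (v ∘ suc))
... | false = trans (+-suc (wt (v ∘ suc)) _) (cong suc (wt-complement (v ∘ suc)))

2∣bit⊕+wt : ∀ {n} (v : Word n) → 2 ∣ bit (⊕ v) + wt v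
2∣bit⊕+wt {zero}  v = 2 ∣0
2∣bit⊕+wt {suc n} v with v zero | ⊕ (v ∘ suc) | 2∣bit⊕+wt (v ∘ suc)
... | false | _     | ih = ih
... | true  | true  | ih = ih
... | true  | false | ih = ∣m∣n⇒∣m+n ∣-refl ih

⊕≡false⇒2∣wt : ∀ {n} (v : Word n) → ⊕ v ≡ false → 2 ∣ wt v
⊕≡false⇒2∣wt v e = subst (λ s → 2 ∣ bit s + wt v) e (2∣bit⊕+wt v)

2∣⇒4∣+ : ∀ {m} → 2 ∣ m → 4 ∣ m + m
2∣⇒4∣+ (divides-refl q) = divides q (sym (*-distribˡ-+ q 2 2))

codeword : ∀ n → (Fin n → Bool) → Word (n + n)
codeword n = lincomb (genK n)

codeword∈CK : ∀ n c → CK n (codeword n c)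
codeword∈CK n c = c , λ _ → refl

codeword-++ : ∀ n c → codeword n c ≗ c ++ ((⊕ c xor_) ∘ c)
codeword-++ n c j with splitAt n j
... | inj₁ a = ·-unit c a
... | inj₂ b = trans (·-shiftʳ c (unit b) true) (cong (⊕ c xor_) (·-unit c b))

codeword-left : ∀ n c i → codeword n c (i ↑ˡ n) ≡ c i
codeword-left n c i = trans (codeword-++ n c (i ↑ˡ n)) (lookup-++ˡ c _ i)

codeword-· : ∀ n c d → codeword n c · codeword n d ≡ (⊕ c ∧ ⊕ d) ∧ isOdd n
codeword-· n c d = begin
  codeword n c · codeword n d
    ≡⟨ ·-cong (codeword-++ n c) (codeword-++ n d) ⟩
  (c ++ ((s xor_) ∘ c)) · (d ++ ((t xor_) ∘ d))
    ≡⟨ ·-++ c d _ _ ⟩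
  c · d xor ((s xor_) ∘ c) · ((t xor_) ∘ d)
    ≡⟨ cong (c · d xor_) (·-shiftˡʳ s t c d) ⟩
  c · d xor ((t ∧ ((s ∧ p) xor s)) xor ((s ∧ t) xor c · d))
    ≡⟨ cong (λ z → c · d xor (z xor ((s ∧ t) xor c · d))) (cross-terms s t) ⟩
  c · d xor ((((s ∧ t) ∧ p) xor (s ∧ t)) xor ((s ∧ t) xor c · d))
    ≡⟨ cong (c · d xor_) (xor-cancel-middle ((s ∧ t) ∧ p) (s ∧ t) (c · d)) ⟩
  c · d xor (((s ∧ t) ∧ p) xor c · d)
    ≡⟨ xor-cancel-outer (c · d) _ ⟩
  (s ∧ t) ∧ p ∎
  where
  s = ⊕ c
  t = ⊕ d
  p = isOdd n
  cross-terms : ∀ s t → t ∧ ((s ∧ p) xor s) ≡ ((s ∧ t) ∧ p) xor (s ∧ t)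
  cross-terms false t     = ∧-zeroʳ t
  cross-terms true  true  = refl
  cross-terms true  false = refl

·-codeword-unit : ∀ n (v : Word (n + n)) i →
                  v · codeword n (unit i) ≡ v (i ↑ˡ n) xor (⊕ (v ∘ (n ↑ʳ_)) xor v (n ↑ʳ i))
·-codeword-unit n v i = begin
  v · codeword n (unit i)
    ≡⟨ ·-cong (++-halves n v) (codeword-++ n (unit i)) ⟩
  (x ++ y) · (unit i ++ ((⊕ (unit i) xor_) ∘ unit i))
    ≡⟨ ·-++ x (unit i) y _ ⟩
  x · unit i xor y · ((⊕ (unit i) xor_) ∘ unit i)
    ≡⟨ cong₂ _xor_ (·-unit x i) (·-shiftʳ y (unit i) (⊕ (unit i))) ⟩
  x i xor ((⊕ (unit i) ∧ ⊕ y) xor y · unit i)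
    ≡⟨ cong₂ (λ s z → x i xor ((s ∧ ⊕ y) xor z)) (⊕-unit i) (·-unit y i) ⟩
  x i xor (⊕ y xor y i) ∎
  where
  x = v ∘ (_↑ˡ n)
  y = v ∘ (n ↑ʳ_)

wt-codeword : ∀ n c → wt (codeword n c) ≡ wt c + wt ((⊕ c xor_) ∘ c)
wt-codeword n c = trans (wt-cong (codeword-++ n c)) (wt-++ c _)

wt-codeword-odd : ∀ n c → ⊕ c ≡ true → wt (codeword n c) ≡ n
wt-codeword-odd n c e =
  trans (wt-codeword n c) (trans (cong (λ s → wt c + wt ((s xor_) ∘ c)) e) (wt-complement c))

wt-codeword-even : ∀ n c → ⊕ c ≡ false → wt (codeword n c) ≡ wt c + wt c
wt-codeword-even n c e = trans (wt-codeword n c) (cong (λ s → wt c + wt ((s xor_) ∘ c)) e)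

CK-wt≡n⊎4∣ : ∀ n {v} → CK n v → wt v ≡ n ⊎ 4 ∣ wt v
CK-wt≡n⊎4∣ n {v} (c , v≗) with ⊕ c in e
... | true  = inj₁ (trans (wt-cong v≗) (wt-codeword-odd n c e))
... | false = inj₂ (subst (4 ∣_) (sym (trans (wt-cong v≗) (wt-codeword-even n c e)))
                          (2∣⇒4∣+ (⊕≡false⇒2∣wt c e)))

CK-selfOrthogonal : ∀ n → isOdd n ≡ false → ∀ {v w} → CK n v → CK n w → v · w ≡ false
CK-selfOrthogonal n even {v} {w} (c , v≗) (d , w≗) = begin
  v · w                             ≡⟨ ·-cong v≗ w≗ ⟩
  codeword n c · codeword n d       ≡⟨ codeword-· n c d ⟩
  (⊕ c ∧ ⊕ d) ∧ isOdd n             ≡⟨ cong ((⊕ c ∧ ⊕ d) ∧_) even ⟩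
  (⊕ c ∧ ⊕ d) ∧ false               ≡⟨ ∧-zeroʳ _ ⟩
  false                             ∎

CK⊥⊆CK : ∀ n → isOdd n ≡ false → ∀ {v} → Dual (CK n) v → CK n v
CK⊥⊆CK n even {v} v⊥ = x , λ j → begin
  v j                        ≡⟨ ++-halves n v j ⟩
  (x ++ y) j                 ≡⟨ ++-cong x x (λ _ → refl) y≗ j ⟩
  (x ++ ((⊕ x xor_) ∘ x)) j  ≡⟨ codeword-++ n x j ⟨
  codeword n x j             ∎
  where
  x = v ∘ (_↑ˡ n)
  y = v ∘ (n ↑ʳ_)
  x≗ : ∀ i → x i ≡ ⊕ y xor y i
  x≗ i = xor≡false⇒≡ _ _ (trans (sym (·-codeword-unit n v i)) (v⊥ _ (codeword∈CK n (unit i))))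
  ⊕x≡⊕y : ⊕ x ≡ ⊕ y
  ⊕x≡⊕y = begin
    ⊕ x                         ≡⟨ ⊕-cong x≗ ⟩
    ⊕ ((⊕ y xor_) ∘ y)          ≡⟨ ⊕-shift (⊕ y) y ⟩
    (⊕ y ∧ isOdd n) xor ⊕ y     ≡⟨ cong (λ b → (⊕ y ∧ b) xor ⊕ y) even ⟩
    (⊕ y ∧ false) xor ⊕ y       ≡⟨ cong (_xor ⊕ y) (∧-zeroʳ (⊕ y)) ⟩
    ⊕ y                         ∎
  y≗ : y ≗ (⊕ x xor_) ∘ x
  y≗ b = sym (trans (cong₂ _xor_ ⊕x≡⊕y (x≗ b)) (xor-cancelˡ (⊕ y) (y b)))

even⇒selfDual : ∀ n → 2 ∣ n → SelfDual (CK n)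
even⇒selfDual n 2∣n v =
  mk⇔ (λ v∈ w w∈ → CK-selfOrthogonal n even v∈ w∈) (CK⊥⊆CK n even)
  where even = Equivalence.from (isOdd≡false⇔2∣ n) 2∣n

selfDual⇒even : ∀ n → SelfDual (CK n) → 2 ∣ n
selfDual⇒even zero      _  = 2 ∣0
selfDual⇒even n@(suc _) sd = Equivalence.to (isOdd≡false⇔2∣ n) (begin
  isOdd n                               ≡⟨ cong (λ s → (s ∧ s) ∧ isOdd n) (⊕-unit {n} zero) ⟨
  (⊕ e₀ ∧ ⊕ e₀) ∧ isOdd n               ≡⟨ codeword-· n e₀ e₀ ⟨
  codeword n e₀ · codeword n e₀         ≡⟨ Equivalence.to (sd _) row∈CK _ row∈CK ⟩
  false                                 ∎)
  where
  e₀ = unit zero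
  row∈CK = codeword∈CK n e₀

CK-doublyEven : ∀ n → 4 ∣ n → ∀ v → CK n v → 4 ∣ wt v
CK-doublyEven n 4∣n v v∈ = [ (λ wt≡n → subst (4 ∣_) (sym wt≡n) 4∣n) , id ]′ (CK-wt≡n⊎4∣ n v∈)

CK-notDoublyEven : ∀ n → ¬ 4 ∣ n → ¬ (∀ v → CK n v → 4 ∣ wt v)
CK-notDoublyEven zero    4∤n _       = 4∤n (4 ∣0)
CK-notDoublyEven n@(suc _) 4∤n doublyEven =
  4∤n (subst (4 ∣_) (wt-codeword-odd n (unit zero) (⊕-unit {n} zero))
                    (doublyEven _ (codeword∈CK n (unit zero))))

CK-hasDim : ∀ n → HasDim (CK n) n
CK-hasDim n = genK n , genK-linIndep , λ _ → mk⇔ id id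
  where
  genK-linIndep : LinIndep (genK n)
  genK-linIndep c c↦𝟘 i = trans (sym (codeword-left n c i)) (c↦𝟘 (i ↑ˡ n))

CK-wt≥4 : ∀ n → 4 ≤ n → ∀ v → CK n v → ¬ (v ≗ 𝟘) → 4 ≤ wt v
CK-wt≥4 n 4≤n v v∈ v≢𝟘 =
  [ (λ wt≡n → subst (4 ≤_) (sym wt≡n) 4≤n)
  , (λ 4∣wt → ∣⇒≤ {{≢-nonZero (v≢𝟘 ∘ wt≡0⇒≗𝟘 v)}} 4∣wt)
  ]′ (CK-wt≡n⊎4∣ n v∈)

CK-minDist : ∀ n → 4 ≤ n → HasMinDist (CK n) 4
CK-minDist (suc zero) (s≤s ())
CK-minDist (suc (suc m)) 4≤n =
  (codeword n e₀₁ , codeword∈CK n e₀₁ , e₀₁-codeword≢𝟘 , wt-e₀₁-codeword) , CK-wt≥4 n 4≤n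
  where
  n = suc (suc m)
  e₀₁ : Fin n → Bool
  e₀₁ zero          = true
  e₀₁ (suc zero)    = true
  e₀₁ (suc (suc _)) = false
  e₀₁-codeword≢𝟘 : ¬ (codeword n e₀₁ ≗ 𝟘)
  e₀₁-codeword≢𝟘 ≗𝟘 with () ← trans (sym (codeword-left n e₀₁ zero)) (≗𝟘 (_↑ˡ_ {n} zero n))
  wt-e₀₁-codeword : wt (codeword n e₀₁) ≡ 4
  wt-e₀₁-codeword =
    trans (wt-codeword-even n e₀₁ (cong (λ b → true xor (true xor b)) (⊕-const {m} false)))
          (cong (λ k → suc (suc k) + suc (suc k)) (wt-𝟘 {m}))

CK-params : ∀ n → 4 ≤ n → IsCodeParams (CK n) n 4
CK-params n 4≤n = CK-hasDim n , CK-minDist n 4≤n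

mainTheorem12 : (∀ (n : ℕ) → SelfDual (CK n) ⇔ 2 ∣ n)
    × (∀ (n : ℕ) → 4 ≤ n → 2 ∣ n →
        (4 ∣ n → TypeII (CK n) × IsCodeParams (CK n) n 4)
        × (¬ 4 ∣ n → TypeI (CK n) × IsCodeParams (CK n) n 4))
mainTheorem12 =
    (λ n → mk⇔ (selfDual⇒even n) (even⇒selfDual n))
  , λ n 4≤n 2∣n →
        (λ 4∣n → (even⇒selfDual n 2∣n , CK-doublyEven n 4∣n) , CK-params n 4≤n)
      , (λ 4∤n → (even⇒selfDual n 2∣n , CK-notDoublyEven n 4∤n) , CK-params n 4≤n)
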